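{- Let $B$ be a connected flag building set on $[n]$ with flag ordering $O=(D,b_1,\dots,b_k)$, $k\ge1$. Then $\Gamma(B|_{b_k})=\Gamma(O)|_{V_k}$ (as complexes on the common vertex set $\{v(b_i): i\in V_k\}$).
   Context: A building set $B$ on a finite set $S$ is a collection of nonempty subsets of $S$ such that (i) if $I,J\in B$ and $I\cap J\neq\emptyset$ then $I\cup J\in B$, and (ii) $\{i\}\in B$ for all $i\in S$; it is connected if $S\in B$. For $I\subseteq[n]$, $\Delta_I$ is the convex hull of the standard basis vectors $e_i$, $i\in I$, and for $B$ on $[n]$ the nestohedron is $P_B=\sum_{I\in B}\Delta_I$. $B$ is flag if the simple polytope $P_B$ is flag (every family of pairwise intersecting facets has nonempty intersection). For $I\subseteq S$, the restriction is $B|_I=\{b\in B: b\subseteq I\}$. A minimal flag building set on $S$ is a connected flag building set on $S$ no proper subset of which is a connected flag building set on $S$ (equivalently, the sets of leaf-descendants of the vertices of a rooted binary tree with leaf set $S$). For non-singleton $b\in B$, a decomposition of $b$ in $B$ is a subset of $B$ forming a minimal flag building set on $b$. A flag ordering $O=(D,b_1,\dots,b_k)$ of a connected flag building set $B$ on $[n]$ consists of a decomposition $D$ of $[n]$ in $B$ and an enumeration $b_1,\dots,b_k$ of $B\setminus D$ such that $B_j:=D\cup\{b_1,\dots,b_j\}$ is a flag building set for all $0\le j\le k$ ($B_0=D$). For $j\in[k]$: $U_j=\{i<j: b_i\not\subseteq b_j$ and there is no $b\in B_{i-1}$ with $b\setminus b_j=b_i\setminus b_j\}$; $V_j=\{i<j: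 b_i\subseteq b_j$ and there is $b\in B_{i-1}$ with $b_i\subsetneq b\subsetneq b_j\}$. $\Gamma(O)$ is the simplicial complex on vertices $v(b_1),\dots,v(b_k)$ whose faces are the cliques of the graph in which, for $i<j$, $v(b_i)$ and $v(b_j)$ are adjacent iff $i\in U_j\cup V_j$. For $I\subseteq[k]$, $\Gamma(O)|_I$ is the induced subcomplex on $\{v(b_i): i\in I\}$. Let $D_k=D|_{b_k}\cup\{b_j: b_j\subseteq b_k,\ j\notin V_k\}$ and let $v_1<\dots<v_m$ be the elements of $V_k$. Then $D_k$ is a decomposition of $b_k$, and $(D_k,b_{v_1},\dots,b_{v_m})$ is a flag ordering of the building set $B|_{b_k}$ on $b_k$; $\Gamma(B|_{b_k})$ denotes $\Gamma$ of this flag ordering, with vertices labelled $v(b_{v_1}),\dots,v(b_{v_m})$. -}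

module Defs where

open import Data.Nat using (ℕ; zero; suc; _≤_)
open import Data.Fin using (Fin; toℕ; fromℕ; _<_)
open import Data.Fin.Subset using (Subset; _∪_; _∩_; _─_; ⁅_⁆; Nonempty; Empty; ⋃)
  renaming (⊤ to full; _∈_ to _∈ₛ_; _⊆_ to _⊆ₛ_; _⊂_ to _⊂ₛ_)
open import Data.List using (List; length)
open import Data.List.Relation.Unary.All using (All)
open import Data.List.Relation.Unary.AllPairs using (AllPairs)
open import Data.List.Membership.Propositional using (_∈_)
open import Data.Product using (Σ; ∃; _×_; _,_)
open import Data.Sum using (_⊎_)
open import Relation.Nullary using (¬_)
open import Relation.Binary.PropositionalEquality using (_≡_)
open import Function using (_∘_)

-- The ground set [n] is Fin n; subsets are Data.Fin.Subset.
-- A collection of subsets of [n] (finite automatically) is a predicate.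
Coll : ℕ → Set₁
Coll n = Subset n → Set

_⊆c_ : ∀ {n} → Coll n → Coll n → Set
A ⊆c B = ∀ x → A x → B x

IsBuildingSet : ∀ {n} → Subset n → Coll n → Set
IsBuildingSet S B =
  (∀ x → B x → Nonempty x × x ⊆ₛ S)
  × (∀ I J → B I → B J → Nonempty (I ∩ J) → B (I ∪ J))
  × (∀ i → i ∈ₛ S → B ⁅ i ⁆)

IsConnected : ∀ {n} → Subset n → Coll n → Set
IsConnected S B = B S

-- Flagness of the nestohedron P_B of a connected building set, expressed through
-- its dual simplicial complex (the nested set complex): every family of elements
-- of B∖{S} that is pairwise nested is nested.
IsFlag : ∀ {n} → Coll n → Set
IsFlag {n} B =
  ∀ (Is : List (Subset n)) → All B Is
  → AllPairs (λ I J → Empty (I ∩ J)) Is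
  → AllPairs (λ I J → ¬ B (I ∪ J)) Is
  → 2 ≤ length Is
  → ¬ B (⋃ Is)

IsConnFlagBS : ∀ {n} → Subset n → Coll n → Set
IsConnFlagBS S B = IsBuildingSet S B × IsConnected S B × IsFlag B

IsMinFlagBS : ∀ {n} → Subset n → Coll n → Set₁
IsMinFlagBS {n} S D =
  IsConnFlagBS S D × (∀ (D' : Coll n) → D' ⊆c D → IsConnFlagBS S D' → D ⊆c D')

IsDecomposition : ∀ {n} → Coll n → Subset n → Coll n → Set₁
IsDecomposition B b D = D ⊆c B × IsMinFlagBS b D

-- An ordering (D, c_1, …, c_m) is given by D and c : Fin m → Subset n
-- (0-based: c i is b_{i+1}).  Pre D c j = D ∪ {c l : l < j}, i.e. B_j.
Pre : ∀ {n m} → Coll n → (Fin m → Subset n) → ℕ → Coll n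
Pre {m = m} D c j x = D x ⊎ Σ (Fin m) (λ l → (suc (toℕ l) ≤ j) × c l ≡ x)

IsFlagOrdering : ∀ {n m} → Coll n → Coll n → (Fin m → Subset n) → Set₁
IsFlagOrdering {n} {m} B D c =
  IsConnFlagBS full B
  × IsDecomposition B full D
  × (∀ i → B (c i))
  × (∀ i → ¬ D (c i))
  × (∀ i j → c i ≡ c j → i ≡ j)
  × (∀ x → B x → ¬ D x → ∃ λ i → c i ≡ x)
  × (∀ j → j ≤ m → IsBuildingSet full (Pre D c j) × IsFlag (Pre D c j))

-- U_j and V_j (as predicates on i); B_{i-1} (1-based) is Pre D c (toℕ i) (0-based).
U : ∀ {n m} → Coll n → (Fin m → Subset n) → Fin m → Fin m → Set
U D c j i = i < j × ¬ (c i ⊆ₛ c j)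
  × ¬ (∃ λ x → Pre D c (toℕ i) x × (x ─ c j) ≡ (c i ─ c j))

V : ∀ {n m} → Coll n → (Fin m → Subset n) → Fin m → Fin m → Set
V D c j i = i < j × c i ⊆ₛ c j
  × (∃ λ x → Pre D c (toℕ i) x × c i ⊂ₛ x × x ⊂ₛ c j)

-- Γ of an ordering: clique complex, faces are finite sets (lists) of vertex
-- labels v(c i), identified with the sets c i.
IsFaceΓ : ∀ {n m} → Coll n → (Fin m → Subset n) → List (Subset n) → Set
IsFaceΓ {m = m} D c F =
  (∀ x → x ∈ F → ∃ λ i → c i ≡ x)
  × (∀ (i j : Fin m) → c i ∈ F → c j ∈ F → i < j → U D c j i ⊎ V D c j i)

IsFaceΓRestr : ∀ {n m} → Coll n → (Fin m → Subset n) → (Fin m → Set)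
  → List (Subset n) → Set
IsFaceΓRestr D c I F = IsFaceΓ D c F × (∀ x → x ∈ F → ∃ λ i → I i × c i ≡ x)

Dk : ∀ {n k} → Coll n → (Fin (suc k) → Subset n) → Coll n
Dk {k = k} D b x =
  (D x × x ⊆ₛ b (fromℕ k))
  ⊎ (∃ λ j → b j ⊆ₛ b (fromℕ k) × ¬ V D b (fromℕ k) j × b j ≡ x)

{-# OPTIONS --safe #-}
-- The two complexes have the same vertices, so it suffices to compare, for i < j in V_k, the
-- conditions i ∈ U_j, i ∈ V_j computed in O with those computed in the ordering of B|_{b_k}.
-- The prefix of the latter before b_i consists of the sets of B_{i-1} inside b_k together
-- with the sets b_l ⊆ b_k with l ∉ V_k and l ≥ i.  Witnesses from B_{i-1} are automatically
-- inside b_k.  A witness b_l of the second kind can be traded for the V_k-witness z of b_i: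
-- if z ∈ B_{l-1} met b_l without being contained in it, then z ∪ b_l ∈ B_{l-1} would lie
-- strictly between b_l and b_k and put l into V_k.  Hence b_i ⊊ z ⊆ b_l with z ∈ B_{i-1}.
module Submission where

open import Defs
open import Data.Nat using (ℕ; suc)
open import Data.Fin using (Fin; fromℕ; _<_)
open import Data.Fin.Subset using (Subset)
open import Data.List using (List)
open import Data.Product using (∃)
open import Relation.Binary.PropositionalEquality using (_≡_)
open import Function using (_∘_; _⇔_)

import Data.Nat as ℕ
import Data.Nat.Properties as ℕ
open import Data.Fin using (toℕ; _≤_)
import Data.Fin.Properties as Fin
open import Data.Fin.Subset using (_∪_; _∩_; _─_; Nonempty)
open import Data.Fin.Subset using ()
  renaming (_∈_ to _∈ₛ_; _∉_ to _∉ₛ_; _⊆_ to _⊆ₛ_; _⊂_ to _⊂ₛ_)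
open import Data.Fin.Subset.Properties
  using (_∈?_; _⊆?_; ⊆-antisym; ⊆-trans; ⊆-⊂-trans; p⊆p∪q; q⊆p∪q; x∈p∪q⁻; x∈p∩q⁺; x∈p∩q⁻;
         x∈p∧x∉q⇒x∈p─q; p─q⊆p)
open import Data.Vec using (_∷_)
open import Data.Vec.Base using (here; there)
open import Data.Bool using (true)
open import Data.Product using (_×_; _,_; proj₁; proj₂)
open import Data.Sum using (_⊎_; inj₁; inj₂)
import Data.Sum as Sum
open import Data.Empty using (⊥-elim)
open import Relation.Nullary using (¬_; yes; no)
open import Relation.Nullary.Decidable using (_×-dec_; ¬?)
open import Relation.Binary.PropositionalEquality using (refl; sym; subst)
open import Relation.Binary.Definitions using (tri<; tri≈; tri>)
open import Function.Bundles using (Equivalence; mk⇔)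
open import Data.List.Membership.Propositional using () renaming (_∈_ to _∈ₗ_)

private
  variable
    n m m' : ℕ

x∈p─q⇒x∉q : ∀ (p q : Subset n) {x} → x ∈ₛ p ─ q → x ∉ₛ q
x∈p─q⇒x∉q (_ ∷ p) (_    ∷ q) {Fin.suc x} (there x∈p─q) (there x∈q) = x∈p─q⇒x∉q p q x∈p─q x∈q
x∈p─q⇒x∉q (_ ∷ p) (true ∷ q) {Fin.zero}  ()            here

⊈⇒∃∉ : ∀ {p q : Subset n} → ¬ p ⊆ₛ q → ∃ λ x → x ∈ₛ p × x ∉ₛ q
⊈⇒∃∉ {p = p} {q} p⊈q with Fin.any? (λ x → (x ∈? p) ×-dec ¬? (x ∈? q))
... | yes witness = witness
... | no none = ⊥-elim (p⊈q p⊆q)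
  where
  p⊆q : p ⊆ₛ q
  p⊆q {x} x∈p with x ∈? q
  ... | yes x∈q = x∈q
  ... | no  x∉q = ⊥-elim (none (x , x∈p , x∉q))

⊆∧≢⇒⊂ : ∀ {p q : Subset n} → p ⊆ₛ q → ¬ p ≡ q → p ⊂ₛ q
⊆∧≢⇒⊂ {p = p} {q} p⊆q p≢q with q ⊆? p
... | yes q⊆p = ⊥-elim (p≢q (⊆-antisym p⊆q q⊆p))
... | no  q⊈p = p⊆q , ⊈⇒∃∉ q⊈p

─-≡⇒⊆ : ∀ {x p q r : Subset n} → x ─ q ≡ p ─ q → p ⊆ₛ r → q ⊆ₛ r → x ⊆ₛ r
─-≡⇒⊆ {p = p} {q} eq p⊆r q⊆r {y} y∈x with y ∈? q
... | yes y∈q = q⊆r y∈q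
... | no  y∉q = p⊆r (p─q⊆p p q (subst (y ∈ₛ_) eq (x∈p∧x∉q⇒x∈p─q y∈x y∉q)))

─-≡-sandwich : ∀ {p z x q : Subset n} → p ⊆ₛ z → z ⊆ₛ x → x ─ q ≡ p ─ q → z ─ q ≡ p ─ q
─-≡-sandwich {p = p} {z} {q = q} p⊆z z⊆x eq = ⊆-antisym z─q⊆p─q p─q⊆z─q
  where
  z─q⊆p─q : z ─ q ⊆ₛ p ─ q
  z─q⊆p─q {y} h =
    subst (y ∈ₛ_) eq (x∈p∧x∉q⇒x∈p─q (z⊆x (p─q⊆p z q h)) (x∈p─q⇒x∉q z q h))
  p─q⊆z─q : p ─ q ⊆ₛ z ─ q
  p─q⊆z─q h = x∈p∧x∉q⇒x∈p─q (p⊆z (p─q⊆p p q h)) (x∈p─q⇒x∉q p q h)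

module _ (D : Coll n) (c : Fin m → Subset n) where

  Pre-mono : ∀ {j j'} → j ℕ.≤ j' → ∀ {x} → Pre D c j x → Pre D c j' x
  Pre-mono j≤j' (inj₁ x∈D)            = inj₁ x∈D
  Pre-mono j≤j' (inj₂ (l , l<j , eq)) = inj₂ (l , ℕ.≤-trans l<j j≤j' , eq)

  Pre-suc⁻ : ∀ l {x} → Pre D c (suc (toℕ l)) x → Pre D c (toℕ l) x ⊎ c l ≡ x
  Pre-suc⁻ l (inj₁ x∈D) = inj₁ (inj₁ x∈D)
  Pre-suc⁻ l (inj₂ (l' , ℕ.s≤s l'≤l , eq)) with ℕ.m≤n⇒m<n∨m≡n l'≤l
  ... | inj₁ l'<l = inj₁ (inj₂ (l' , l'<l , eq))
  ... | inj₂ l'≡l = inj₂ (subst (λ t → c t ≡ _) (Fin.toℕ-injective l'≡l) eq)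

strictMono⇒reflects-< : ∀ (v : Fin m' → Fin m) → (∀ a a' → a < a' → v a < v a') →
                        ∀ a a' → v a < v a' → a < a'
strictMono⇒reflects-< v v-mono a a' va<va' with Fin.<-cmp a a'
... | tri< a<a' _ _ = a<a'
... | tri≈ _ refl _ = ⊥-elim (ℕ.<-irrefl refl va<va')
... | tri> _ _ a'<a = ⊥-elim (ℕ.<-asym va<va' (v-mono a' a a'<a))

Edge : Coll n → (Fin m → Subset n) → Fin m → Fin m → Set
Edge D c j i = U D c j i ⊎ V D c j i

module _ {D' D : Coll n} {c : Fin m → Subset n} {v : Fin m' → Fin m}
  (c-injective : ∀ i j → c i ≡ c j → i ≡ j)
  (v-mono : ∀ a a' → a < a' → v a < v a')
  {I : Fin m → Set} (v∈I : ∀ a → I (v a)) (I⊆v : ∀ i → I i → ∃ λ a → v a ≡ i)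
  (edge⇔ : ∀ a a' → a < a' → Edge D' (c ∘ v) a' a ⇔ Edge D c (v a') (v a))
  where

  IsFaceΓ-reindex : ∀ F → IsFaceΓ D' (c ∘ v) F ⇔ IsFaceΓRestr D c I F
  IsFaceΓ-reindex F = mk⇔ to from
    where
    to : IsFaceΓ D' (c ∘ v) F → IsFaceΓRestr D c I F
    to (vertices , edges) = (vertices′ , edges′) , vertices∈I
      where
      vertices′ : ∀ x → x ∈ₗ F → ∃ λ i → c i ≡ x
      vertices′ x x∈F = let a , eq = vertices x x∈F in v a , eq
      vertices∈I : ∀ x → x ∈ₗ F → ∃ λ i → I i × c i ≡ x
      vertices∈I x x∈F = let a , eq = vertices x x∈F in v a , v∈I a , eq
      edges′ : ∀ i j → c i ∈ₗ F → c j ∈ₗ F → i < j → Edge D c j i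
      edges′ i j ci∈F cj∈F i<j
        with vertices (c i) ci∈F | vertices (c j) cj∈F
      ... | a , eqa | a' , eqa'
        with c-injective _ _ eqa | c-injective _ _ eqa'
      ... | refl | refl =
        Equivalence.to (edge⇔ a a' a<a') (edges a a' ci∈F cj∈F a<a')
        where
        a<a' : a < a'
        a<a' = strictMono⇒reflects-< v v-mono a a' i<j
    from : IsFaceΓRestr D c I F → IsFaceΓ D' (c ∘ v) F
    from ((_ , edges) , vertices∈I) = vertices , edges′
      where
      vertices : ∀ x → x ∈ₗ F → ∃ λ a → c (v a) ≡ x
      vertices x x∈F with vertices∈I x x∈F
      ... | i , i∈I , eq with I⊆v i i∈I
      ...   | a , refl = a , eq
      edges′ : ∀ a a' → c (v a) ∈ₗ F → c (v a') ∈ₗ F → a < a' → Edge D' (c ∘ v) a' a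
      edges′ a a' ca∈F ca'∈F a<a' =
        Equivalence.from (edge⇔ a a' a<a')
          (edges (v a) (v a') ca∈F ca'∈F (v-mono a a' a<a'))

module _ {k} {B D : Coll n} {b : Fin (suc k) → Subset n} (fo : IsFlagOrdering B D b) where

  private
    K : Fin (suc k)
    K = fromℕ k

  b-injective : ∀ i j → b i ≡ b j → i ≡ j
  b-injective = let (_ , _ , _ , _ , inj , _) = fo in inj

  b-nonempty : ∀ i → Nonempty (b i)
  b-nonempty i = let ((bs , _) , _) , _ , b∈B , _ = fo in proj₁ (bs (b i) (b∈B i))

  Pre-∪-closed : ∀ {j} → j ℕ.≤ suc k → ∀ {x y} → Pre D b j x → Pre D b j y →
                 Nonempty (x ∩ y) → Pre D b j (x ∪ y)
  Pre-∪-closed j≤ {x} {y} = let _ , _ , _ , _ , _ , _ , prefixes = fo in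
    proj₁ (proj₂ (proj₁ (prefixes _ j≤))) x y

  last∉Pre : ∀ (i : Fin (suc k)) → ¬ Pre D b (toℕ i) (b K)
  last∉Pre i (inj₁ bK∈D) = let _ , _ , _ , b∉D , _ = fo in b∉D K bK∈D
  last∉Pre i (inj₂ (l , l<i , eq)) with b-injective l K eq
  ... | refl = Fin.<-irrefl refl (ℕ.<-≤-trans l<i (Fin.≤fromℕ i))

  union-witnesses-V : ∀ l → l < K → b l ⊆ₛ b K → ∀ {z} → Pre D b (toℕ l) z → z ⊆ₛ b K →
                      Nonempty (z ∩ b l) → ¬ z ⊆ₛ b l → V D b K l
  union-witnesses-V l l<K bl⊆bK {z} z∈B z⊆bK meet z⊈bl =
    l<K , bl⊆bK , w , w∈B , ⊆∧≢⇒⊂ (q⊆p∪q z (b l)) (w≢bl ∘ sym) , ⊆∧≢⇒⊂ w⊆bK w≢bK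
    where
    w : Subset n
    w = z ∪ b l
    w≢bl : ¬ w ≡ b l
    w≢bl eq = z⊈bl (λ h → subst (_ ∈ₛ_) eq (p⊆p∪q (b l) h))
    w∈B : Pre D b (toℕ l) w
    w∈B with Pre-suc⁻ D b l (Pre-∪-closed (ℕ.s≤s (Fin.toℕ≤pred[n] l))
                           (Pre-mono D b (ℕ.n≤1+n _) z∈B) (inj₂ (l , ℕ.≤-refl , refl)) meet)
    ... | inj₁ w∈B = w∈B
    ... | inj₂ bl≡w = ⊥-elim (w≢bl (sym bl≡w))
    w⊆bK : w ⊆ₛ b K
    w⊆bK h = Sum.[ z⊆bK , bl⊆bK ] (x∈p∪q⁻ z (b l) h)
    w≢bK : ¬ w ≡ b K
    w≢bK eq = last∉Pre l (subst (Pre D b (toℕ l)) eq w∈B)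

  nonV-absorbs : ∀ l → ¬ V D b K l → b l ⊆ₛ b K → ∀ {z} → Pre D b (toℕ l) z → z ⊆ₛ b K →
                 Nonempty (z ∩ b l) → z ⊆ₛ b l
  nonV-absorbs l l∉V bl⊆bK {z} z∈B z⊆bK meet with l Fin.≟ K | z ⊆? b l
  ... | yes refl | _        = z⊆bK
  ... | no  _    | yes z⊆bl = z⊆bl
  ... | no  l≢K  | no  z⊈bl = ⊥-elim (l∉V
        (union-witnesses-V l (Fin.≤∧≢⇒< (Fin.≤fromℕ l) l≢K) bl⊆bK z∈B z⊆bK meet z⊈bl))

  module _ {m} {v : Fin m → Fin (suc k)}
    (v-mono : ∀ a a' → a < a' → v a < v a')
    (v∈V : ∀ a → V D b K (v a))
    (V⊆v : ∀ i → V D b K i → ∃ λ a → v a ≡ i)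
    where

    private
      c : Fin m → Subset n
      c = b ∘ v

      bv⊆bK : ∀ a → c a ⊆ₛ b K
      bv⊆bK a = proj₁ (proj₂ (v∈V a))

    Pre⇒Pre-Dk : ∀ a {x} → x ⊆ₛ b K → Pre D b (toℕ (v a)) x → Pre (Dk D b) c (toℕ a) x
    Pre⇒Pre-Dk a x⊆bK (inj₁ x∈D) = inj₁ (inj₁ (x∈D , x⊆bK))
    Pre⇒Pre-Dk a x⊆bK (inj₂ (l , l<va , refl)) with Fin.any? (λ a' → v a' Fin.≟ l)
    ... | yes (a' , refl) =
      inj₂ (a' , strictMono⇒reflects-< v v-mono a' a l<va , refl)
    ... | no  l∉v = inj₁ (inj₂ (l , x⊆bK , (λ l∈V → l∉v (V⊆v l l∈V)) , refl))

    Pre-Dk⁻ : ∀ a {x} → Pre (Dk D b) c (toℕ a) x →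
              Pre D b (toℕ (v a)) x
              ⊎ ∃ λ l → ¬ V D b K l × b l ⊆ₛ b K × v a ≤ l × b l ≡ x
    Pre-Dk⁻ a (inj₁ (inj₁ (x∈D , _)))         = inj₁ (inj₁ x∈D)
    Pre-Dk⁻ a (inj₁ (inj₂ (l , bl⊆bK , l∉V , eq))) with l Fin.<? v a
    ... | yes l<va = inj₁ (inj₂ (l , l<va , eq))
    ... | no  l≮va = inj₂ (l , l∉V , bl⊆bK , ℕ.≮⇒≥ l≮va , eq)
    Pre-Dk⁻ a (inj₂ (a' , a'<a , eq))        = inj₁ (inj₂ (v a' , v-mono a' a a'<a , eq))

    V-witness-below-nonV : ∀ a l → ¬ V D b K l → b l ⊆ₛ b K → v a ≤ l →
                           Nonempty (c a ∩ b l) →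
                           ∃ λ z → Pre D b (toℕ (v a)) z × c a ⊂ₛ z × z ⊆ₛ b l
    V-witness-below-nonV a l l∉V bl⊆bK va≤l (f , f∈ca∩bl) =
      let _ , _ , z , z∈B , ca⊂z , z⊂bK = v∈V a
          f∈ca , f∈bl = x∈p∩q⁻ (c a) (b l) f∈ca∩bl
      in z , z∈B , ca⊂z ,
         nonV-absorbs l l∉V bl⊆bK (Pre-mono D b va≤l z∈B) (proj₁ z⊂bK)
           (f , x∈p∩q⁺ (proj₁ ca⊂z f∈ca , f∈bl))

    module _ (a a' : Fin m) (a<a' : a < a') where

      U-Dk⇒U : U (Dk D b) c a' a → U D b (v a') (v a)
      U-Dk⇒U (_ , ca⊈ca' , no-witness) = v-mono a a' a<a' , ca⊈ca' , λ where
        (x , x∈B , eq) → no-witness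
          (x , Pre⇒Pre-Dk a (─-≡⇒⊆ eq (bv⊆bK a) (bv⊆bK a')) x∈B , eq)

      U⇒U-Dk : U D b (v a') (v a) → U (Dk D b) c a' a
      U⇒U-Dk (_ , ca⊈ca' , no-witness) = a<a' , ca⊈ca' , no-witness ∘ witness
        where
        witness : (∃ λ x → Pre (Dk D b) c (toℕ a) x × x ─ c a' ≡ c a ─ c a') →
                  ∃ λ y → Pre D b (toℕ (v a)) y × y ─ c a' ≡ c a ─ c a'
        witness (x , x∈B′ , eq) with Pre-Dk⁻ a x∈B′
        ... | inj₁ x∈B = x , x∈B , eq
        ... | inj₂ (l , l∉V , bl⊆bK , va≤l , refl) =
          let f , f∈ca , f∉ca' = ⊈⇒∃∉ ca⊈ca'
              f∈bl = p─q⊆p (b l) (c a')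
                       (subst (f ∈ₛ_) (sym eq) (x∈p∧x∉q⇒x∈p─q f∈ca f∉ca'))
              z , z∈B , ca⊂z , z⊆bl =
                V-witness-below-nonV a l l∉V bl⊆bK va≤l (f , x∈p∩q⁺ (f∈ca , f∈bl))
          in z , z∈B , ─-≡-sandwich (proj₁ ca⊂z) z⊆bl eq

      V⇒V-Dk : V D b (v a') (v a) → V (Dk D b) c a' a
      V⇒V-Dk (_ , ca⊆ca' , x , x∈B , ca⊂x , x⊂ca') =
        a<a' , ca⊆ca' , x ,
        Pre⇒Pre-Dk a (⊆-trans (proj₁ x⊂ca') (bv⊆bK a')) x∈B , ca⊂x , x⊂ca'

      V-Dk⇒V : V (Dk D b) c a' a → V D b (v a') (v a)
      V-Dk⇒V (_ , ca⊆ca' , x , x∈B′ , ca⊂x , x⊂ca') with Pre-Dk⁻ a x∈B′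
      ... | inj₁ x∈B = v-mono a a' a<a' , ca⊆ca' , x , x∈B , ca⊂x , x⊂ca'
      ... | inj₂ (l , l∉V , bl⊆bK , va≤l , refl) =
        let f , f∈ca = b-nonempty (v a)
            z , z∈B , ca⊂z , z⊆bl = V-witness-below-nonV a l l∉V bl⊆bK va≤l
                                      (f , x∈p∩q⁺ (f∈ca , proj₁ ca⊂x f∈ca))
        in v-mono a a' a<a' , ca⊆ca' , z , z∈B , ca⊂z , ⊆-⊂-trans z⊆bl x⊂ca'

      Edge-Dk⇔Edge : Edge (Dk D b) c a' a ⇔ Edge D b (v a') (v a)
      Edge-Dk⇔Edge = mk⇔ (Sum.map U-Dk⇒U V-Dk⇒V) (Sum.map U⇒U-Dk V⇒V-Dk)

proposition3p4 : ∀ {n k : ℕ} (B D : Coll n) (b : Fin (suc k) → Subset n)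
    → IsFlagOrdering B D b
    → ∀ {m : ℕ} (v : Fin m → Fin (suc k))
    → (∀ a a' → a < a' → v a < v a')
    → (∀ a → V D b (fromℕ k) (v a))
    → (∀ i → V D b (fromℕ k) i → ∃ λ a → v a ≡ i)
    → ∀ (F : List (Subset n))
    → IsFaceΓ (Dk D b) (b ∘ v) F ⇔ IsFaceΓRestr D b (V D b (fromℕ k)) F
proposition3p4 B D b fo v v-mono v∈V V⊆v =
  IsFaceΓ-reindex (b-injective fo) v-mono v∈V V⊆v (Edge-Dk⇔Edge fo v-mono v∈V V⊆v)
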